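{- The four relations $\sqsupseteq_{1\text{ -nv}}$, $\sqsupseteq_{2\text{ -nv}}$, $\sqsupseteq_{1\text{ -dly}}$ and $\sqsupseteq_{2\text{ -dly}}$ on $\mathcal P$ coincide.
   Context: TACS. Fix a countable set $\Lambda$ of action names; $\overline{\Lambda}=\{\overline a : a\in\Lambda\}$ with $\overline{\overline a}=a$; $\mathcal A=\Lambda\cup\overline\Lambda\cup\{\tau\}$ is the set of actions (ranged over by $\alpha$), and $a$ ranges over $\Lambda\cup\overline\Lambda$. Terms (set $\widehat{\mathcal P}$) are generated by $P::=\mathbf 0\mid x\mid \alpha.P\mid \sigma.P\mid P+P\mid P|P\mid P\backslash L\mid P[f]\mid \mu x.P$, where $x$ ranges over a countably infinite set of variables, $L\subseteq\mathcal A\setminus\{\tau\}$ is finite, and $f:\mathcal A\to\mathcal A$ satisfies $f(\tau)=\tau$, $f(\overline a)=\overline{f(a)}$ and $f(\alpha)\neq\alpha$ for only finitely many $\alpha$. $\mu x$ binds $x$; $P[Q/x]$ denotes substitution of $Q$ for the free occurrences of $x$. A variable is guarded in a term if each of its occurrences is in the scope of an action prefix $\alpha.\_$ (a $\sigma$-prefix does not count). In every term $\mu x.P$, $x$ must be guarded in $P$. Processes (set $\mathcal P$) are the closed terms. $\overline L=\{\overline a: a\in L\}$. Urgent sets: $\mathcal U(\sigma.P)=\mathcal U(\mathbf 0)=\mathcal U(x)=\emptyset$, $\mathcal U(\alpha.P)=\{\alpha\}$, $\mathcal U(P+Q)=\mathcal U(P)\cup\mathcal U(Q)$, $\mathcal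 U(P|Q)=\mathcal U(P)\cup\mathcal U(Q)\cup\{\tau\mid \mathcal U(P)\cap\overline{\mathcal U(Q)}\neq\emptyset\}$, $\mathcal U(P\backslash L)=\mathcal U(P)\setminus(L\cup\overline L)$, $\mathcal U(P[f])=\{f(\alpha):\alpha\in\mathcal U(P)\}$, $\mathcal U(\mu x.P)=\mathcal U(P)$. Action transitions $\xrightarrow{\alpha}$ are the least relations with: $\alpha.P\xrightarrow{\alpha}P$; if $P\xrightarrow{\alpha}P'$ then $\sigma.P\xrightarrow{\alpha}P'$, $\mu x.P\xrightarrow{\alpha}P'[\mu x.P/x]$, $P+Q\xrightarrow{\alpha}P'$, $Q+P\xrightarrow{\alpha}P'$, $P|Q\xrightarrow{\alpha}P'|Q$, $Q|P\xrightarrow{\alpha}Q|P'$, $P[f]\xrightarrow{f(\alpha)}P'[f]$, and $P\backslash L\xrightarrow{\alpha}P'\backslash L$ if $\alpha\notin L\cup\overline L$; if $P\xrightarrow{a}P'$ and $Q\xrightarrow{\overline a}Q'$ then $P|Q\xrightarrow{\tau}P'|Q'$. Clock transitions $\xrightarrow{\sigma}_i$ ($i\in\{1,2\}$) are the least relations with: $\mathbf 0\xrightarrow{\sigma}_i\mathbf 0$; $a.P\xrightarrow{\sigma}_i a.P$ for $a\in\Lambda\cup\overline\Lambda$; $\sigma.P\xrightarrow{\sigma}_iP$; if $P\xrightarrow{\sigma}_iP'$ then $\mu x.P\xrightarrow{\sigma}_iP'[\mu x.P/x]$, $P\backslash L\xrightarrow{\sigma}_iP'\backslash L$, $P[f]\xrightarrow{\sigma}_iP'[f]$;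 if $P\xrightarrow{\sigma}_iP'$ and $Q\xrightarrow{\sigma}_iQ'$ then $P+Q\xrightarrow{\sigma}_iP'+Q'$, and $P|Q\xrightarrow{\sigma}_iP'|Q'$ provided $\tau\notin\mathcal U(P|Q)$; and, only for $i=2$: if $P\xrightarrow{\sigma}_2P'$ then $\sigma.P\xrightarrow{\sigma}_2P'$. $\xrightarrow{\sigma}_i^{*}$ and $\xrightarrow{\sigma}_i^{+}$ denote reflexive-transitive and transitive closure. For $i\in\{1,2\}$, $\mathcal R\subseteq\mathcal P\times\mathcal P$ is an i-naive faster-than relation if for all $(P,Q)\in\mathcal R$, $\alpha\in\mathcal A$: (1) $P\xrightarrow{\alpha}P'$ implies $\exists Q'$. $Q\xrightarrow{\alpha}Q'$, $(P',Q')\in\mathcal R$; (2) $Q\xrightarrow{\alpha}Q'$ implies $\exists P'$. $P\xrightarrow{\alpha}P'$, $(P',Q')\in\mathcal R$; (3) $P\xrightarrow{\sigma}_iP'$ implies $\exists Q'$. $Q\xrightarrow{\sigma}_iQ'$, $(P',Q')\in\mathcal R$. $\mathcal R$ is an i-delayed faster-than relation if for all $(P,Q)\in\mathcal R$, $\alpha\in\mathcal A$: (1) $P\xrightarrow{\alpha}P'$ implies $\exists Q'$. $Q\xrightarrow{\sigma}_i^{*}\xrightarrow{\alpha}\xrightarrow{\sigma}_i^{*}Q'$, $(P',Q')\in\mathcal R$; (2) $Q\xrightarrow{\alpha}Q'$ implies $\exists P'$. $P\xrightarrow{\alpha}P'$, $(P',Q')\in\mathcal R$; (3) $P\xrightarrow{\sigma}_iP'$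 implies $\exists Q'$. $Q\xrightarrow{\sigma}_i^{+}Q'$, $(P',Q')\in\mathcal R$. $P\sqsupseteq_{i\text{ -nv}}Q$ (resp. $P\sqsupseteq_{i\text{ -dly}}Q$) iff $(P,Q)$ lies in some i-naive (resp. i-delayed) faster-than relation. -}

module Defs where

open import Data.Nat using (ℕ; zero; suc; _<_; _≟_) renaming (compare to ℕcompare)
open import Data.Nat as Nat using (Ordering; less; equal; greater)
open import Data.List using (List)
open import Data.List.Membership.Propositional using (_∈_; _∉_)
open import Data.Product using (Σ; ∃; _×_; _,_)
open import Data.Sum using (_⊎_)
open import Data.Empty using (⊥)
open import Data.Unit using (⊤)
open import Relation.Nullary using (¬_)
open import Relation.Binary.PropositionalEquality using (_≡_; _≢_)
open import Relation.Binary.Construct.Closure.ReflexiveTransitive using (Star)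
open import Relation.Binary.Construct.Closure.Transitive using (TransClosure)

-- Actions.  Λ = ℕ (a countable set of action names).
-- Lab = Λ ∪ Λ̄ (visible actions), Act = Lab ∪ {τ}.

data Lab : Set where
  nm  : ℕ → Lab
  co  : ℕ → Lab

comp : Lab → Lab
comp (nm n) = co n
comp (co n) = nm n

data Act : Set where
  τ   : Act
  lab : Lab → Act

-- Since f(ā) = \overline{f(a)}
-- must be defined, f maps visible actions to visible actions, so f is
-- given by its restriction to Lab (and extended by f τ = τ).
record Relabel : Set where
  field
    fn     : Lab → Lab
    fcomp  : ∀ a → fn (comp a) ≡ comp (fn a)
    finite : ∃ λ (D : List Lab) → ∀ a → a ∉ D → fn a ≡ a
open Relabel public

app : Relabel → Act → Act
app f τ       = τ
app f (lab a) = lab (fn f a)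

-- α ∈ L ∪ L̄   (L a finite subset of 𝒜∖{τ}, given as a list)
InLL : List Lab → Act → Set
InLL L τ       = ⊥
InLL L (lab a) = a ∈ L ⊎ comp a ∈ L

-- Terms, with variables as de Bruijn indices (μ binds index 0).

data Term : Set where
  𝟎    : Term
  var  : ℕ → Term
  _∙_  : Act → Term → Term
  σ∙_  : Term → Term
  _⊕_  : Term → Term → Term
  _∥_  : Term → Term → Term
  _∖_  : Term → List Lab → Term
  _⟦_⟧ : Term → Relabel → Term
  μ    : Term → Term

infixr 7 _∙_ σ∙_
infixl 5 _⊕_
infixl 4 _∥_

shift : ℕ → Term → Term
shift c 𝟎 = 𝟎
shift c (var i) with ℕcompare i c
... | less _ _    = var i
... | equal _     = var (suc i)
... | greater _ _ = var (suc i)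
shift c (α ∙ P)  = α ∙ shift c P
shift c (σ∙ P)   = σ∙ shift c P
shift c (P ⊕ Q)  = shift c P ⊕ shift c Q
shift c (P ∥ Q)  = shift c P ∥ shift c Q
shift c (P ∖ L)  = shift c P ∖ L
shift c (P ⟦ f ⟧) = shift c P ⟦ f ⟧
shift c (μ P)    = μ (shift (suc c) P)

-- capture-avoiding substitution of Q for variable k (variables above k
-- are decremented, as the binder of k is removed)
substAt : ℕ → Term → Term → Term
substAt k Q 𝟎 = 𝟎
substAt k Q (var i) with ℕcompare i k
... | less _ _          = var i
... | equal _           = Q
... | greater _ j       = var (Nat._+_ k j)  -- i = suc (k + j), decrement
substAt k Q (α ∙ P)   = α ∙ substAt k Q P
substAt k Q (σ∙ P)    = σ∙ substAt k Q P
substAt k Q (P ⊕ R)   = substAt k Q P ⊕ substAt k Q R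
substAt k Q (P ∥ R)   = substAt k Q P ∥ substAt k Q R
substAt k Q (P ∖ L)   = substAt k Q P ∖ L
substAt k Q (P ⟦ f ⟧) = substAt k Q P ⟦ f ⟧
substAt k Q (μ P)     = μ (substAt (suc k) (shift 0 Q) P)

_[_/0] : Term → Term → Term
P [ Q /0] = substAt 0 Q P

Guarded : ℕ → Term → Set
Guarded k 𝟎 = ⊤
Guarded k (var i) = i ≢ k
Guarded k (α ∙ P) = ⊤
Guarded k (σ∙ P) = Guarded k P
Guarded k (P ⊕ Q) = Guarded k P × Guarded k Q
Guarded k (P ∥ Q) = Guarded k P × Guarded k Q
Guarded k (P ∖ L) = Guarded k P
Guarded k (P ⟦ f ⟧) = Guarded k P
Guarded k (μ P) = Guarded (suc k) P

WF : Term → Set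
WF 𝟎 = ⊤
WF (var i) = ⊤
WF (α ∙ P) = WF P
WF (σ∙ P) = WF P
WF (P ⊕ Q) = WF P × WF Q
WF (P ∥ Q) = WF P × WF Q
WF (P ∖ L) = WF P
WF (P ⟦ f ⟧) = WF P
WF (μ P) = Guarded 0 P × WF P

ClosedUnder : ℕ → Term → Set
ClosedUnder n 𝟎 = ⊤
ClosedUnder n (var i) = i < n
ClosedUnder n (α ∙ P) = ClosedUnder n P
ClosedUnder n (σ∙ P) = ClosedUnder n P
ClosedUnder n (P ⊕ Q) = ClosedUnder n P × ClosedUnder n Q
ClosedUnder n (P ∥ Q) = ClosedUnder n P × ClosedUnder n Q
ClosedUnder n (P ∖ L) = ClosedUnder n P
ClosedUnder n (P ⟦ f ⟧) = ClosedUnder n P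
ClosedUnder n (μ P) = ClosedUnder (suc n) P

Process : Set
Process = Σ Term λ P → ClosedUnder 0 P × WF P

term : Process → Term
term (P , _) = P

data _∈U_ : Act → Term → Set where
  u-pre  : ∀ {α P} → α ∈U (α ∙ P)
  u-sumˡ : ∀ {α P Q} → α ∈U P → α ∈U (P ⊕ Q)
  u-sumʳ : ∀ {α P Q} → α ∈U Q → α ∈U (P ⊕ Q)
  u-parˡ : ∀ {α P Q} → α ∈U P → α ∈U (P ∥ Q)
  u-parʳ : ∀ {α P Q} → α ∈U Q → α ∈U (P ∥ Q)
  u-com  : ∀ {a P Q} → lab a ∈U P → lab (comp a) ∈U Q → τ ∈U (P ∥ Q)
  u-res  : ∀ {α P L} → α ∈U P → ¬ InLL L α → α ∈U (P ∖ L)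
  u-rel  : ∀ {α P f} → α ∈U P → app f α ∈U (P ⟦ f ⟧)
  u-rec  : ∀ {α P} → α ∈U P → α ∈U μ P

data _—[_]→_ : Term → Act → Term → Set where
  act  : ∀ {α P} → (α ∙ P) —[ α ]→ P
  sig  : ∀ {α P P'} → P —[ α ]→ P' → (σ∙ P) —[ α ]→ P'
  rec  : ∀ {α P P'} → P —[ α ]→ P' → μ P —[ α ]→ (P' [ μ P /0])
  sumˡ : ∀ {α P P' Q} → P —[ α ]→ P' → (P ⊕ Q) —[ α ]→ P'
  sumʳ : ∀ {α P P' Q} → P —[ α ]→ P' → (Q ⊕ P) —[ α ]→ P'
  parˡ : ∀ {α P P' Q} → P —[ α ]→ P' → (P ∥ Q) —[ α ]→ (P' ∥ Q)
  parʳ : ∀ {α P P' Q} → P —[ α ]→ P' → (Q ∥ P) —[ α ]→ (Q ∥ P')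
  rel  : ∀ {α P P' f} → P —[ α ]→ P' → (P ⟦ f ⟧) —[ app f α ]→ (P' ⟦ f ⟧)
  res  : ∀ {α P P' L} → P —[ α ]→ P' → ¬ InLL L α → (P ∖ L) —[ α ]→ (P' ∖ L)
  com  : ∀ {a P P' Q Q'} → P —[ lab a ]→ P' → Q —[ lab (comp a) ]→ Q' →
         (P ∥ Q) —[ τ ]→ (P' ∥ Q')

data Clk : Set where
  c1 c2 : Clk

data _—σ[_]→_ : Term → Clk → Term → Set where
  t-nil  : ∀ {i} → 𝟎 —σ[ i ]→ 𝟎
  t-act  : ∀ {i a P} → (lab a ∙ P) —σ[ i ]→ (lab a ∙ P)
  t-sig  : ∀ {i P} → (σ∙ P) —σ[ i ]→ P
  t-rec  : ∀ {i P P'} → P —σ[ i ]→ P' → μ P —σ[ i ]→ (P' [ μ P /0])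
  t-res  : ∀ {i P P' L} → P —σ[ i ]→ P' → (P ∖ L) —σ[ i ]→ (P' ∖ L)
  t-rel  : ∀ {i P P' f} → P —σ[ i ]→ P' → (P ⟦ f ⟧) —σ[ i ]→ (P' ⟦ f ⟧)
  t-sum  : ∀ {i P P' Q Q'} → P —σ[ i ]→ P' → Q —σ[ i ]→ Q' →
           (P ⊕ Q) —σ[ i ]→ (P' ⊕ Q')
  t-par  : ∀ {i P P' Q Q'} → P —σ[ i ]→ P' → Q —σ[ i ]→ Q' →
           ¬ (τ ∈U (P ∥ Q)) → (P ∥ Q) —σ[ i ]→ (P' ∥ Q')
  t-sig2 : ∀ {P P'} → P —σ[ c2 ]→ P' → (σ∙ P) —σ[ c2 ]→ P'

_—σ[_]→*_ : Term → Clk → Term → Set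
P —σ[ i ]→* Q = Star (λ X Y → X —σ[ i ]→ Y) P Q

_—σ[_]→⁺_ : Term → Clk → Term → Set
P —σ[ i ]→⁺ Q = TransClosure (λ X Y → X —σ[ i ]→ Y) P Q

PRel : Set₁
PRel = Process → Process → Set

IsNaive : Clk → PRel → Set
IsNaive i R = ∀ P Q → R P Q →
    (∀ α (P' : Process) → term P —[ α ]→ term P' →
       ∃ λ (Q' : Process) → term Q —[ α ]→ term Q' × R P' Q')
  × (∀ α (Q' : Process) → term Q —[ α ]→ term Q' →
       ∃ λ (P' : Process) → term P —[ α ]→ term P' × R P' Q')
  × (∀ (P' : Process) → term P —σ[ i ]→ term P' →
       ∃ λ (Q' : Process) → term Q —σ[ i ]→ term Q' × R P' Q')

IsDelayed : Clk → PRel → Set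
IsDelayed i R = ∀ P Q → R P Q →
    (∀ α (P' : Process) → term P —[ α ]→ term P' →
       ∃ λ (Q' : Process) →
         (∃ λ Q₁ → ∃ λ Q₂ → term Q —σ[ i ]→* Q₁ × Q₁ —[ α ]→ Q₂
                            × Q₂ —σ[ i ]→* term Q')
         × R P' Q')
  × (∀ α (Q' : Process) → term Q —[ α ]→ term Q' →
       ∃ λ (P' : Process) → term P —[ α ]→ term P' × R P' Q')
  × (∀ (P' : Process) → term P —σ[ i ]→ term P' →
       ∃ λ (Q' : Process) → term Q —σ[ i ]→⁺ term Q' × R P' Q')

_⊒nv[_]_ : Process → Clk → Process → Set₁
P ⊒nv[ i ] Q = ∃ λ (R : PRel) → IsNaive i R × R P Q

_⊒dly[_]_ : Process → Clk → Process → Set₁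
P ⊒dly[ i ] Q = ∃ λ (R : PRel) → IsDelayed i R × R P Q

-- Call Y an advancement of X (X ⇝ Y) when Y arises from X by discarding σ-prefixes
-- that a clock tick could reach, unfolding recursion on the way.  Advancement
-- preserves action transitions in both directions, and every clock tick of an
-- advanced term, under either clock rule, is matched by one tick of the original
-- under the first rule followed by further advancement.  Consequently, closing a
-- delayed faster-than relation on the right under reverse advancement gives a
-- 1-naive one, and closing a 1-naive relation on the left under advancement gives a
-- 2-naive one; every naive relation is trivially delayed.

module Submission where

open import Defs
open import Data.Empty using (⊥-elim)
open import Data.Nat using (ℕ; zero; suc; pred; _+_; _<_; _≤_; z≤n; s≤s; less; equal; greater)
  renaming (compare to ℕcompare)
open import Data.Nat.Properties
  using (<-irrefl; <-asym; <-≤-trans; ≤-trans; ≤-pred; n≤1+n; m≤m+n; 1+n≰n; m≢1+m+n; <-≤-connex; <⇒≢)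
open import Data.Product using (∃; _×_; _,_)
open import Data.Sum using (inj₁; inj₂)
open import Data.Unit using (tt)
open import Function.Base using (_∘_)
open import Function.Bundles using (_⇔_; mk⇔)
open import Relation.Binary.Construct.Closure.ReflexiveTransitive as Star using (Star; ε; _◅_; _◅◅_)
open import Relation.Binary.Construct.Closure.Transitive using ([_]; _∷_)
open import Relation.Binary.PropositionalEquality
  using (_≡_; refl; sym; trans; cong; cong₂; subst)

data Position : ℕ → ℕ → Set where
  below : ∀ {i k} → i < k → Position i k
  at    : ∀ {k} → Position k k
  above : ∀ {j k} → k ≤ j → Position (suc j) k

position : ∀ i k → Position i k
position zero    zero    = at
position zero    (suc k) = below (s≤s z≤n)
position (suc i) zero    = above z≤n
position (suc i) (suc k) with position i k
... | below p = below (s≤s p)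
... | at      = at
... | above p = above (s≤s p)

substAt-var-< : ∀ {k i} S → i < k → substAt k S (var i) ≡ var i
substAt-var-< {k} {i} S i<k with ℕcompare i k
... | less _ _    = refl
... | equal _     = ⊥-elim (<-irrefl refl i<k)
... | greater _ j = ⊥-elim (<-asym i<k (s≤s (m≤m+n k j)))

substAt-var-≡ : ∀ {k i} S → i ≡ k → substAt k S (var i) ≡ S
substAt-var-≡ {k} {i} S i≡k with ℕcompare i k
... | less _ j    = ⊥-elim (m≢1+m+n i i≡k)
... | equal _     = refl
... | greater _ j = ⊥-elim (m≢1+m+n k (sym i≡k))

substAt-var-> : ∀ {k j} S → k ≤ j → substAt k S (var (suc j)) ≡ var j
substAt-var-> {k} {j} S k≤j with ℕcompare (suc j) k
... | less _ m    = ⊥-elim (1+n≰n (≤-trans (s≤s (≤-trans (n≤1+n j) (m≤m+n (suc j) m))) k≤j))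
... | equal _     = ⊥-elim (1+n≰n k≤j)
... | greater _ _ = refl

shift-var-< : ∀ {c i} → i < c → shift c (var i) ≡ var i
shift-var-< {c} {i} i<c with ℕcompare i c
... | less _ _    = refl
... | equal _     = ⊥-elim (<-irrefl refl i<c)
... | greater _ j = ⊥-elim (<-asym i<c (s≤s (m≤m+n c j)))

shift-var-≥ : ∀ {c i} → c ≤ i → shift c (var i) ≡ var (suc i)
shift-var-≥ {c} {i} c≤i with ℕcompare i c
... | less _ m    = ⊥-elim (1+n≰n (≤-trans (s≤s (m≤m+n i m)) c≤i))
... | equal _     = refl
... | greater _ _ = refl

shift-shift : ∀ {d c} X → d ≤ c → shift (suc c) (shift d X) ≡ shift d (shift c X)
shift-shift 𝟎 d≤c = refl
shift-shift {d} {c} (var i) d≤c with <-≤-connex i d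
... | inj₁ i<d
  rewrite shift-var-< i<d | shift-var-< (<-≤-trans i<d d≤c)
        | shift-var-< {suc c} (≤-trans i<d (≤-trans d≤c (n≤1+n c))) | shift-var-< i<d = refl
... | inj₂ d≤i with <-≤-connex i c
...   | inj₁ i<c
  rewrite shift-var-≥ d≤i | shift-var-< i<c | shift-var-< {suc c} (s≤s i<c) | shift-var-≥ d≤i = refl
...   | inj₂ c≤i
  rewrite shift-var-≥ d≤i | shift-var-≥ c≤i | shift-var-≥ {suc c} (s≤s c≤i)
        | shift-var-≥ (≤-trans d≤i (n≤1+n i)) = refl
shift-shift (α ∙ X)   d≤c = cong (α ∙_) (shift-shift X d≤c)
shift-shift (σ∙ X)    d≤c = cong σ∙_ (shift-shift X d≤c)
shift-shift (X ⊕ Y)   d≤c = cong₂ _⊕_ (shift-shift X d≤c) (shift-shift Y d≤c)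
shift-shift (X ∥ Y)   d≤c = cong₂ _∥_ (shift-shift X d≤c) (shift-shift Y d≤c)
shift-shift (X ∖ L)   d≤c = cong (_∖ L) (shift-shift X d≤c)
shift-shift (X ⟦ f ⟧) d≤c = cong (_⟦ f ⟧) (shift-shift X d≤c)
shift-shift (μ X)     d≤c = cong μ (shift-shift X (s≤s d≤c))

shift-substAt : ∀ {c m} S T → c ≤ m →
                shift c (substAt m S T) ≡ substAt (suc m) (shift c S) (shift c T)
shift-substAt S 𝟎 c≤m = refl
shift-substAt {c} {m} S (var i) c≤m with position i m
... | below i<m with <-≤-connex i c
...   | inj₁ i<c
  rewrite substAt-var-< S i<m | shift-var-< i<c
        | substAt-var-< (shift c S) (≤-trans i<m (n≤1+n m)) = refl
...   | inj₂ c≤i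
  rewrite substAt-var-< S i<m | shift-var-≥ c≤i | substAt-var-< (shift c S) (s≤s i<m) = refl
shift-substAt {c} {m} S (var i) c≤m | at
  rewrite substAt-var-≡ {m} S refl | shift-var-≥ c≤m | substAt-var-≡ {suc m} (shift c S) refl = refl
shift-substAt {c} {m} S (var i) c≤m | above {j} m≤j
  rewrite substAt-var-> S m≤j | shift-var-≥ (≤-trans c≤m m≤j)
        | shift-var-≥ (≤-trans c≤m (≤-trans m≤j (n≤1+n j))) | substAt-var-> (shift c S) (s≤s m≤j) = refl
shift-substAt S (α ∙ T)   c≤m = cong (α ∙_) (shift-substAt S T c≤m)
shift-substAt S (σ∙ T)    c≤m = cong σ∙_ (shift-substAt S T c≤m)
shift-substAt S (T ⊕ U)   c≤m = cong₂ _⊕_ (shift-substAt S T c≤m) (shift-substAt S U c≤m)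
shift-substAt S (T ∥ U)   c≤m = cong₂ _∥_ (shift-substAt S T c≤m) (shift-substAt S U c≤m)
shift-substAt S (T ∖ L)   c≤m = cong (_∖ L) (shift-substAt S T c≤m)
shift-substAt S (T ⟦ f ⟧) c≤m = cong (_⟦ f ⟧) (shift-substAt S T c≤m)
shift-substAt {c} {m} S (μ T) c≤m =
  cong μ (trans (shift-substAt (shift 0 S) T (s≤s c≤m))
                (cong (λ S′ → substAt (suc (suc m)) S′ (shift (suc c) T)) (shift-shift S z≤n)))

substAt-shift : ∀ c S T → substAt c S (shift c T) ≡ T
substAt-shift c S 𝟎 = refl
substAt-shift c S (var i) with <-≤-connex i c
... | inj₁ i<c rewrite shift-var-< i<c | substAt-var-< S i<c = refl
... | inj₂ c≤i rewrite shift-var-≥ c≤i | substAt-var-> S c≤i = refl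
substAt-shift c S (α ∙ T)   = cong (α ∙_) (substAt-shift c S T)
substAt-shift c S (σ∙ T)    = cong σ∙_ (substAt-shift c S T)
substAt-shift c S (T ⊕ U)   = cong₂ _⊕_ (substAt-shift c S T) (substAt-shift c S U)
substAt-shift c S (T ∥ U)   = cong₂ _∥_ (substAt-shift c S T) (substAt-shift c S U)
substAt-shift c S (T ∖ L)   = cong (_∖ L) (substAt-shift c S T)
substAt-shift c S (T ⟦ f ⟧) = cong (_⟦ f ⟧) (substAt-shift c S T)
substAt-shift c S (μ T)     = cong μ (substAt-shift (suc c) (shift 0 S) T)

substAt-substAt : ∀ j k S V T →
  substAt (j + k) S (substAt j V T)
    ≡ substAt j (substAt (j + k) S V) (substAt (suc (j + k)) (shift j S) T)
substAt-substAt j k S V 𝟎 = refl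
substAt-substAt j k S V (var i) with position i j
... | below i<j
  rewrite substAt-var-< V i<j | substAt-var-< S (≤-trans i<j (m≤m+n j k))
        | substAt-var-< (shift j S) (≤-trans i<j (≤-trans (m≤m+n j k) (n≤1+n (j + k))))
        | substAt-var-< (substAt (j + k) S V) i<j = refl
... | at
  rewrite substAt-var-≡ {j} V refl | substAt-var-< (shift j S) (s≤s (m≤m+n j k))
        | substAt-var-≡ {j} (substAt (j + k) S V) refl = refl
... | above {m} j≤m with position m (j + k)
...   | below m<j+k
  rewrite substAt-var-> V j≤m | substAt-var-< S m<j+k | substAt-var-< (shift j S) (s≤s m<j+k)
        | substAt-var-> (substAt (j + k) S V) j≤m = refl
...   | at
  rewrite substAt-var-> V j≤m | substAt-var-≡ {j + k} S refl
        | substAt-var-≡ {suc (j + k)} (shift j S) refl = sym (substAt-shift j _ S)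
...   | above j+k≤n
  rewrite substAt-var-> V j≤m | substAt-var-> S j+k≤n | substAt-var-> (shift j S) (s≤s j+k≤n)
        | substAt-var-> (substAt (j + k) S V) (≤-trans (m≤m+n j k) j+k≤n) = refl
substAt-substAt j k S V (α ∙ T)   = cong (α ∙_) (substAt-substAt j k S V T)
substAt-substAt j k S V (σ∙ T)    = cong σ∙_ (substAt-substAt j k S V T)
substAt-substAt j k S V (T ⊕ U)   = cong₂ _⊕_ (substAt-substAt j k S V T) (substAt-substAt j k S V U)
substAt-substAt j k S V (T ∥ U)   = cong₂ _∥_ (substAt-substAt j k S V T) (substAt-substAt j k S V U)
substAt-substAt j k S V (T ∖ L)   = cong (_∖ L) (substAt-substAt j k S V T)
substAt-substAt j k S V (T ⟦ f ⟧) = cong (_⟦ f ⟧) (substAt-substAt j k S V T)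
substAt-substAt j k S V (μ T) =
  cong μ (trans (substAt-substAt (suc j) k (shift 0 S) (shift 0 V) T)
                (cong₂ (λ W S′ → substAt (suc j) W (substAt (suc (suc (j + k))) S′ T))
                       (sym (shift-substAt S V z≤n)) (shift-shift S z≤n)))

substAt-[/0] : ∀ k S V T →
  substAt k S (T [ V /0]) ≡ substAt (suc k) (shift 0 S) T [ substAt k S V /0]
substAt-[/0] k S V T = substAt-substAt 0 k S V T

Guarded-shift-< : ∀ {k c} T → k < c → Guarded k T → Guarded k (shift c T)
Guarded-shift-< 𝟎 k<c g = tt
Guarded-shift-< {k} {c} (var i) k<c g with <-≤-connex i c
... | inj₁ i<c rewrite shift-var-< i<c = g
... | inj₂ c≤i rewrite shift-var-≥ c≤i = λ i+1≡k → <⇒≢ (<-≤-trans k<c (≤-trans c≤i (n≤1+n i))) (sym i+1≡k)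
Guarded-shift-< (α ∙ T)   k<c g       = tt
Guarded-shift-< (σ∙ T)    k<c g       = Guarded-shift-< T k<c g
Guarded-shift-< (T ⊕ U)   k<c (g , h) = Guarded-shift-< T k<c g , Guarded-shift-< U k<c h
Guarded-shift-< (T ∥ U)   k<c (g , h) = Guarded-shift-< T k<c g , Guarded-shift-< U k<c h
Guarded-shift-< (T ∖ L)   k<c g       = Guarded-shift-< T k<c g
Guarded-shift-< (T ⟦ f ⟧) k<c g       = Guarded-shift-< T k<c g
Guarded-shift-< (μ T)     k<c g       = Guarded-shift-< T (s≤s k<c) g

Guarded-shift-≥ : ∀ {k c} T → c ≤ k → Guarded k T → Guarded (suc k) (shift c T)
Guarded-shift-≥ 𝟎 c≤k g = tt
Guarded-shift-≥ {k} {c} (var i) c≤k g with <-≤-connex i c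
... | inj₁ i<c rewrite shift-var-< i<c = <⇒≢ (<-≤-trans i<c (≤-trans c≤k (n≤1+n k)))
... | inj₂ c≤i rewrite shift-var-≥ c≤i = λ i+1≡k+1 → g (cong pred i+1≡k+1)
Guarded-shift-≥ (α ∙ T)   c≤k g       = tt
Guarded-shift-≥ (σ∙ T)    c≤k g       = Guarded-shift-≥ T c≤k g
Guarded-shift-≥ (T ⊕ U)   c≤k (g , h) = Guarded-shift-≥ T c≤k g , Guarded-shift-≥ U c≤k h
Guarded-shift-≥ (T ∥ U)   c≤k (g , h) = Guarded-shift-≥ T c≤k g , Guarded-shift-≥ U c≤k h
Guarded-shift-≥ (T ∖ L)   c≤k g       = Guarded-shift-≥ T c≤k g
Guarded-shift-≥ (T ⟦ f ⟧) c≤k g       = Guarded-shift-≥ T c≤k g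
Guarded-shift-≥ (μ T)     c≤k g       = Guarded-shift-≥ T (s≤s c≤k) g

Guarded-shift : ∀ {c} T → Guarded c (shift c T)
Guarded-shift 𝟎 = tt
Guarded-shift {c} (var i) with <-≤-connex i c
... | inj₁ i<c rewrite shift-var-< i<c = <⇒≢ i<c
... | inj₂ c≤i rewrite shift-var-≥ c≤i = λ i+1≡c → <⇒≢ (s≤s c≤i) (sym i+1≡c)
Guarded-shift (α ∙ T)   = tt
Guarded-shift (σ∙ T)    = Guarded-shift T
Guarded-shift (T ⊕ U)   = Guarded-shift T , Guarded-shift U
Guarded-shift (T ∥ U)   = Guarded-shift T , Guarded-shift U
Guarded-shift (T ∖ L)   = Guarded-shift T
Guarded-shift (T ⟦ f ⟧) = Guarded-shift T
Guarded-shift (μ T)     = Guarded-shift T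

Guarded-substAt-≤ : ∀ {j k} S T → j ≤ k → Guarded (suc k) T → Guarded k S → Guarded k (substAt j S T)
Guarded-substAt-≤ S 𝟎 j≤k g h = tt
Guarded-substAt-≤ {j} S (var i) j≤k g h with position i j
... | below i<j rewrite substAt-var-< S i<j = <⇒≢ (<-≤-trans i<j j≤k)
... | at        rewrite substAt-var-≡ {j} S refl = h
... | above j≤m rewrite substAt-var-> S j≤m = λ m≡k → g (cong suc m≡k)
Guarded-substAt-≤ S (α ∙ T)   j≤k g       h = tt
Guarded-substAt-≤ S (σ∙ T)    j≤k g       h = Guarded-substAt-≤ S T j≤k g h
Guarded-substAt-≤ S (T ⊕ U)   j≤k (g , g′) h = Guarded-substAt-≤ S T j≤k g h , Guarded-substAt-≤ S U j≤k g′ h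
Guarded-substAt-≤ S (T ∥ U)   j≤k (g , g′) h = Guarded-substAt-≤ S T j≤k g h , Guarded-substAt-≤ S U j≤k g′ h
Guarded-substAt-≤ S (T ∖ L)   j≤k g       h = Guarded-substAt-≤ S T j≤k g h
Guarded-substAt-≤ S (T ⟦ f ⟧) j≤k g       h = Guarded-substAt-≤ S T j≤k g h
Guarded-substAt-≤ S (μ T)     j≤k g       h =
  Guarded-substAt-≤ (shift 0 S) T (s≤s j≤k) g (Guarded-shift-≥ S z≤n h)

Guarded-substAt-> : ∀ {j k} S T → k < j → Guarded k T → Guarded k S → Guarded k (substAt j S T)
Guarded-substAt-> S 𝟎 k<j g h = tt
Guarded-substAt-> {j} S (var i) k<j g h with position i j
... | below i<j rewrite substAt-var-< S i<j = g
... | at        rewrite substAt-var-≡ {j} S refl = h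
... | above j≤m rewrite substAt-var-> S j≤m = λ m≡k → <⇒≢ (<-≤-trans k<j j≤m) (sym m≡k)
Guarded-substAt-> S (α ∙ T)   k<j g        h = tt
Guarded-substAt-> S (σ∙ T)    k<j g        h = Guarded-substAt-> S T k<j g h
Guarded-substAt-> S (T ⊕ U)   k<j (g , g′) h = Guarded-substAt-> S T k<j g h , Guarded-substAt-> S U k<j g′ h
Guarded-substAt-> S (T ∥ U)   k<j (g , g′) h = Guarded-substAt-> S T k<j g h , Guarded-substAt-> S U k<j g′ h
Guarded-substAt-> S (T ∖ L)   k<j g        h = Guarded-substAt-> S T k<j g h
Guarded-substAt-> S (T ⟦ f ⟧) k<j g        h = Guarded-substAt-> S T k<j g h
Guarded-substAt-> S (μ T)     k<j g        h =
  Guarded-substAt-> (shift 0 S) T (s≤s k<j) g (Guarded-shift-≥ S z≤n h)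

ClosedUnder-shift : ∀ {n c} T → ClosedUnder n T → ClosedUnder (suc n) (shift c T)
ClosedUnder-shift 𝟎 cl = tt
ClosedUnder-shift {n} {c} (var i) i<n with <-≤-connex i c
... | inj₁ i<c rewrite shift-var-< i<c = ≤-trans i<n (n≤1+n n)
... | inj₂ c≤i rewrite shift-var-≥ c≤i = s≤s i<n
ClosedUnder-shift (α ∙ T)   cl         = ClosedUnder-shift T cl
ClosedUnder-shift (σ∙ T)    cl         = ClosedUnder-shift T cl
ClosedUnder-shift (T ⊕ U)   (cl , cl′) = ClosedUnder-shift T cl , ClosedUnder-shift U cl′
ClosedUnder-shift (T ∥ U)   (cl , cl′) = ClosedUnder-shift T cl , ClosedUnder-shift U cl′
ClosedUnder-shift (T ∖ L)   cl         = ClosedUnder-shift T cl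
ClosedUnder-shift (T ⟦ f ⟧) cl         = ClosedUnder-shift T cl
ClosedUnder-shift (μ T)     cl         = ClosedUnder-shift T cl

ClosedUnder-substAt : ∀ {k n} S T → k ≤ n →
                      ClosedUnder (suc n) T → ClosedUnder n S → ClosedUnder n (substAt k S T)
ClosedUnder-substAt S 𝟎 k≤n cl clS = tt
ClosedUnder-substAt {k} S (var i) k≤n i<n+1 clS with position i k
... | below i<k rewrite substAt-var-< S i<k = <-≤-trans i<k k≤n
... | at        rewrite substAt-var-≡ {k} S refl = clS
... | above k≤m rewrite substAt-var-> S k≤m = ≤-pred i<n+1
ClosedUnder-substAt S (α ∙ T)   k≤n cl         clS = ClosedUnder-substAt S T k≤n cl clS
ClosedUnder-substAt S (σ∙ T)    k≤n cl         clS = ClosedUnder-substAt S T k≤n cl clS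
ClosedUnder-substAt S (T ⊕ U)   k≤n (cl , cl′) clS =
  ClosedUnder-substAt S T k≤n cl clS , ClosedUnder-substAt S U k≤n cl′ clS
ClosedUnder-substAt S (T ∥ U)   k≤n (cl , cl′) clS =
  ClosedUnder-substAt S T k≤n cl clS , ClosedUnder-substAt S U k≤n cl′ clS
ClosedUnder-substAt S (T ∖ L)   k≤n cl         clS = ClosedUnder-substAt S T k≤n cl clS
ClosedUnder-substAt S (T ⟦ f ⟧) k≤n cl         clS = ClosedUnder-substAt S T k≤n cl clS
ClosedUnder-substAt S (μ T)     k≤n cl         clS =
  ClosedUnder-substAt (shift 0 S) T (s≤s k≤n) cl (ClosedUnder-shift S clS)

WF-shift : ∀ {c} T → WF T → WF (shift c T)
WF-shift 𝟎 wf = tt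
WF-shift {c} (var i) wf with <-≤-connex i c
... | inj₁ i<c rewrite shift-var-< i<c = tt
... | inj₂ c≤i rewrite shift-var-≥ c≤i = tt
WF-shift (α ∙ T)   wf         = WF-shift T wf
WF-shift (σ∙ T)    wf         = WF-shift T wf
WF-shift (T ⊕ U)   (wf , wf′) = WF-shift T wf , WF-shift U wf′
WF-shift (T ∥ U)   (wf , wf′) = WF-shift T wf , WF-shift U wf′
WF-shift (T ∖ L)   wf         = WF-shift T wf
WF-shift (T ⟦ f ⟧) wf         = WF-shift T wf
WF-shift (μ T)     (g , wf)   = Guarded-shift-< T (s≤s z≤n) g , WF-shift T wf

WF-substAt : ∀ {k} S T → WF T → WF S → WF (substAt k S T)
WF-substAt S 𝟎 wf wfS = tt
WF-substAt {k} S (var i) wf wfS with position i k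
... | below i<k rewrite substAt-var-< S i<k = tt
... | at        rewrite substAt-var-≡ {k} S refl = wfS
... | above k≤m rewrite substAt-var-> S k≤m = tt
WF-substAt S (α ∙ T)   wf         wfS = WF-substAt S T wf wfS
WF-substAt S (σ∙ T)    wf         wfS = WF-substAt S T wf wfS
WF-substAt S (T ⊕ U)   (wf , wf′) wfS = WF-substAt S T wf wfS , WF-substAt S U wf′ wfS
WF-substAt S (T ∥ U)   (wf , wf′) wfS = WF-substAt S T wf wfS , WF-substAt S U wf′ wfS
WF-substAt S (T ∖ L)   wf         wfS = WF-substAt S T wf wfS
WF-substAt S (T ⟦ f ⟧) wf         wfS = WF-substAt S T wf wfS
WF-substAt S (μ T)     (g , wf)   wfS =
  Guarded-substAt-> (shift 0 S) T (s≤s z≤n) g (Guarded-shift S) , WF-substAt (shift 0 S) T wf (WF-shift S wfS)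

∈U-substAt : ∀ {α k S T} → α ∈U T → α ∈U substAt k S T
∈U-substAt u-pre       = u-pre
∈U-substAt (u-sumˡ u)  = u-sumˡ (∈U-substAt u)
∈U-substAt (u-sumʳ u)  = u-sumʳ (∈U-substAt u)
∈U-substAt (u-parˡ u)  = u-parˡ (∈U-substAt u)
∈U-substAt (u-parʳ u)  = u-parʳ (∈U-substAt u)
∈U-substAt (u-com u v) = u-com (∈U-substAt u) (∈U-substAt v)
∈U-substAt (u-res u l) = u-res (∈U-substAt u) l
∈U-substAt (u-rel u)   = u-rel (∈U-substAt u)
∈U-substAt (u-rec u)   = u-rec (∈U-substAt u)

act-substAt : ∀ {α k S T T′} → T —[ α ]→ T′ → substAt k S T —[ α ]→ substAt k S T′
act-substAt act       = act
act-substAt (sig d)   = sig (act-substAt d)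
act-substAt (sumˡ d)  = sumˡ (act-substAt d)
act-substAt (sumʳ d)  = sumʳ (act-substAt d)
act-substAt (parˡ d)  = parˡ (act-substAt d)
act-substAt (parʳ d)  = parʳ (act-substAt d)
act-substAt (rel d)   = rel (act-substAt d)
act-substAt (res d l) = res (act-substAt d) l
act-substAt (com d e) = com (act-substAt d) (act-substAt e)
act-substAt {α} {k} {S} (rec {P = T} {T′} d) =
  subst (substAt k S (μ T) —[ α ]→_) (sym (substAt-[/0] k S (μ T) T′)) (rec (act-substAt d))

substAt-act⁻¹ : ∀ {k S α U} T → Guarded k T → substAt k S T —[ α ]→ U →
                ∃ λ T′ → T —[ α ]→ T′ × U ≡ substAt k S T′
-- Abstracting over the comparison made by substAt lets d's source compute:
-- either a variable, which has no transitions, or S in place of var k, excluded by g.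
substAt-act⁻¹ {k} (var i) g d with ℕcompare i k | d
... | less _ _    | ()
... | equal _     | _  = ⊥-elim (g refl)
... | greater _ _ | ()
substAt-act⁻¹ (α ∙ T) g act = T , act , refl
substAt-act⁻¹ (σ∙ T) g (sig d) with substAt-act⁻¹ T g d
... | T′ , d′ , refl = T′ , sig d′ , refl
substAt-act⁻¹ (T ⊕ U) (g , h) (sumˡ d) with substAt-act⁻¹ T g d
... | T′ , d′ , refl = T′ , sumˡ d′ , refl
substAt-act⁻¹ (T ⊕ U) (g , h) (sumʳ d) with substAt-act⁻¹ U h d
... | U′ , d′ , refl = U′ , sumʳ d′ , refl
substAt-act⁻¹ (T ∥ U) (g , h) (parˡ d) with substAt-act⁻¹ T g d
... | T′ , d′ , refl = (T′ ∥ U) , parˡ d′ , refl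
substAt-act⁻¹ (T ∥ U) (g , h) (parʳ d) with substAt-act⁻¹ U h d
... | U′ , d′ , refl = (T ∥ U′) , parʳ d′ , refl
substAt-act⁻¹ (T ∥ U) (g , h) (com d e) with substAt-act⁻¹ T g d | substAt-act⁻¹ U h e
... | T′ , d′ , refl | U′ , e′ , refl = (T′ ∥ U′) , com d′ e′ , refl
substAt-act⁻¹ (T ∖ L) g (res d l) with substAt-act⁻¹ T g d
... | T′ , d′ , refl = T′ ∖ L , res d′ l , refl
substAt-act⁻¹ (T ⟦ f ⟧) g (rel d) with substAt-act⁻¹ T g d
... | T′ , d′ , refl = T′ ⟦ f ⟧ , rel d′ , refl
substAt-act⁻¹ {k} {S} (μ T) g (rec d) with substAt-act⁻¹ T g d
... | T′ , d′ , refl = T′ [ μ T /0] , rec d′ , sym (substAt-[/0] k S (μ T) T′)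

substAt-clk⁻¹ : ∀ {k S i U} T → Guarded k T → substAt k S T —σ[ i ]→ U →
                ∃ λ T′ → T —σ[ i ]→ T′ × U ≡ substAt k S T′
substAt-clk⁻¹ 𝟎 g t-nil = 𝟎 , t-nil , refl
substAt-clk⁻¹ {k} (var i) g d with ℕcompare i k | d
... | less _ _    | ()
... | equal _     | _  = ⊥-elim (g refl)
... | greater _ _ | ()
substAt-clk⁻¹ (lab a ∙ T) g t-act = lab a ∙ T , t-act , refl
substAt-clk⁻¹ (σ∙ T) g t-sig = T , t-sig , refl
substAt-clk⁻¹ (σ∙ T) g (t-sig2 d) with substAt-clk⁻¹ T g d
... | T′ , d′ , refl = T′ , t-sig2 d′ , refl
substAt-clk⁻¹ (T ⊕ U) (g , h) (t-sum d e) with substAt-clk⁻¹ T g d | substAt-clk⁻¹ U h e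
... | T′ , d′ , refl | U′ , e′ , refl = T′ ⊕ U′ , t-sum d′ e′ , refl
substAt-clk⁻¹ (T ∥ U) (g , h) (t-par d e τ∉) with substAt-clk⁻¹ T g d | substAt-clk⁻¹ U h e
... | T′ , d′ , refl | U′ , e′ , refl = (T′ ∥ U′) , t-par d′ e′ (λ u → τ∉ (∈U-substAt u)) , refl
substAt-clk⁻¹ (T ∖ L) g (t-res d) with substAt-clk⁻¹ T g d
... | T′ , d′ , refl = T′ ∖ L , t-res d′ , refl
substAt-clk⁻¹ (T ⟦ f ⟧) g (t-rel d) with substAt-clk⁻¹ T g d
... | T′ , d′ , refl = T′ ⟦ f ⟧ , t-rel d′ , refl
substAt-clk⁻¹ {k} {S} (μ T) g (t-rec d) with substAt-clk⁻¹ T g d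
... | T′ , d′ , refl = T′ [ μ T /0] , t-rec d′ , sym (substAt-[/0] k S (μ T) T′)

infix 3 _⇝_ _⇝*_

-- Unlike a clock step, ⇝ ignores the side condition τ ∉ 𝒰(X ∥ Y); since 𝒰(σ∙ X) = ∅,
-- advancement can only enlarge urgent sets (∈U-⇝).
data _⇝_ : Term → Term → Set where
  ⇝-refl : ∀ {X} → X ⇝ X
  ⇝-σ    : ∀ {X Y} → X ⇝ Y → σ∙ X ⇝ Y
  ⇝-⊕    : ∀ {X X′ Y Y′} → X ⇝ X′ → Y ⇝ Y′ → X ⊕ Y ⇝ X′ ⊕ Y′
  ⇝-∥    : ∀ {X X′ Y Y′} → X ⇝ X′ → Y ⇝ Y′ → X ∥ Y ⇝ X′ ∥ Y′
  ⇝-∖    : ∀ {X X′ L} → X ⇝ X′ → X ∖ L ⇝ X′ ∖ L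
  ⇝-⟦⟧   : ∀ {X X′ f} → X ⇝ X′ → X ⟦ f ⟧ ⇝ X′ ⟦ f ⟧
  ⇝-μ    : ∀ {X X′} → X ⇝ X′ → μ X ⇝ X′ [ μ X /0]

_⇝*_ : Term → Term → Set
_⇝*_ = Star _⇝_

substAt-⇝ : ∀ {k S T T′} → T ⇝ T′ → substAt k S T ⇝ substAt k S T′
substAt-⇝ ⇝-refl      = ⇝-refl
substAt-⇝ (⇝-σ a)     = ⇝-σ (substAt-⇝ a)
substAt-⇝ (⇝-⊕ a b)   = ⇝-⊕ (substAt-⇝ a) (substAt-⇝ b)
substAt-⇝ (⇝-∥ a b)   = ⇝-∥ (substAt-⇝ a) (substAt-⇝ b)
substAt-⇝ (⇝-∖ a)     = ⇝-∖ (substAt-⇝ a)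
substAt-⇝ (⇝-⟦⟧ a)    = ⇝-⟦⟧ (substAt-⇝ a)
substAt-⇝ {k} {S} (⇝-μ {T} {T′} a) =
  subst (substAt k S (μ T) ⇝_) (sym (substAt-[/0] k S (μ T) T′)) (⇝-μ (substAt-⇝ a))

clk⇒⇝ : ∀ {i X Y} → X —σ[ i ]→ Y → X ⇝ Y
clk⇒⇝ t-nil         = ⇝-refl
clk⇒⇝ t-act         = ⇝-refl
clk⇒⇝ t-sig         = ⇝-σ ⇝-refl
clk⇒⇝ (t-sig2 d)    = ⇝-σ (clk⇒⇝ d)
clk⇒⇝ (t-rec d)     = ⇝-μ (clk⇒⇝ d)
clk⇒⇝ (t-res d)     = ⇝-∖ (clk⇒⇝ d)
clk⇒⇝ (t-rel d)     = ⇝-⟦⟧ (clk⇒⇝ d)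
clk⇒⇝ (t-sum d e)   = ⇝-⊕ (clk⇒⇝ d) (clk⇒⇝ e)
clk⇒⇝ (t-par d e _) = ⇝-∥ (clk⇒⇝ d) (clk⇒⇝ e)

clk*⇒⇝* : ∀ {i X Y} → X —σ[ i ]→* Y → X ⇝* Y
clk*⇒⇝* = Star.map clk⇒⇝

clk₁⇒clk : ∀ {i X Y} → X —σ[ c1 ]→ Y → X —σ[ i ]→ Y
clk₁⇒clk t-nil          = t-nil
clk₁⇒clk t-act          = t-act
clk₁⇒clk t-sig          = t-sig
clk₁⇒clk (t-rec d)      = t-rec (clk₁⇒clk d)
clk₁⇒clk (t-res d)      = t-res (clk₁⇒clk d)
clk₁⇒clk (t-rel d)      = t-rel (clk₁⇒clk d)
clk₁⇒clk (t-sum d e)    = t-sum (clk₁⇒clk d) (clk₁⇒clk e)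
clk₁⇒clk (t-par d e τ∉) = t-par (clk₁⇒clk d) (clk₁⇒clk e) τ∉

clk⇒clk₁⇝ : ∀ {i X Y} → X —σ[ i ]→ Y → ∃ λ X′ → X —σ[ c1 ]→ X′ × X′ ⇝ Y
clk⇒clk₁⇝ t-nil      = _ , t-nil , ⇝-refl
clk⇒clk₁⇝ t-act      = _ , t-act , ⇝-refl
clk⇒clk₁⇝ t-sig      = _ , t-sig , ⇝-refl
clk⇒clk₁⇝ (t-sig2 d) = _ , t-sig , clk⇒⇝ d
clk⇒clk₁⇝ (t-rec d) with clk⇒clk₁⇝ d
... | _ , d′ , a = _ , t-rec d′ , substAt-⇝ a
clk⇒clk₁⇝ (t-res d) with clk⇒clk₁⇝ d
... | _ , d′ , a = _ , t-res d′ , ⇝-∖ a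
clk⇒clk₁⇝ (t-rel d) with clk⇒clk₁⇝ d
... | _ , d′ , a = _ , t-rel d′ , ⇝-⟦⟧ a
clk⇒clk₁⇝ (t-sum d e) with clk⇒clk₁⇝ d | clk⇒clk₁⇝ e
... | _ , d′ , a | _ , e′ , b = _ , t-sum d′ e′ , ⇝-⊕ a b
clk⇒clk₁⇝ (t-par d e τ∉) with clk⇒clk₁⇝ d | clk⇒clk₁⇝ e
... | _ , d′ , a | _ , e′ , b = _ , t-par d′ e′ τ∉ , ⇝-∥ a b

∈U-⇝ : ∀ {α X Y} → α ∈U X → X ⇝ Y → α ∈U Y
∈U-⇝ u           ⇝-refl      = u
∈U-⇝ (u-sumˡ u)  (⇝-⊕ a b)   = u-sumˡ (∈U-⇝ u a)
∈U-⇝ (u-sumʳ u)  (⇝-⊕ a b)   = u-sumʳ (∈U-⇝ u b)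
∈U-⇝ (u-parˡ u)  (⇝-∥ a b)   = u-parˡ (∈U-⇝ u a)
∈U-⇝ (u-parʳ u)  (⇝-∥ a b)   = u-parʳ (∈U-⇝ u b)
∈U-⇝ (u-com u v) (⇝-∥ a b)   = u-com (∈U-⇝ u a) (∈U-⇝ v b)
∈U-⇝ (u-res u l) (⇝-∖ a)     = u-res (∈U-⇝ u a) l
∈U-⇝ (u-rel u)   (⇝-⟦⟧ a)    = u-rel (∈U-⇝ u a)
∈U-⇝ (u-rec u)   (⇝-μ a)     = ∈U-substAt (∈U-⇝ u a)

Guarded-⇝ : ∀ {k X Y} → Guarded k X → X ⇝ Y → Guarded k Y
Guarded-⇝ g       ⇝-refl    = g
Guarded-⇝ g       (⇝-σ a)   = Guarded-⇝ g a
Guarded-⇝ (g , h) (⇝-⊕ a b) = Guarded-⇝ g a , Guarded-⇝ h b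
Guarded-⇝ (g , h) (⇝-∥ a b) = Guarded-⇝ g a , Guarded-⇝ h b
Guarded-⇝ g       (⇝-∖ a)   = Guarded-⇝ g a
Guarded-⇝ g       (⇝-⟦⟧ a)  = Guarded-⇝ g a
Guarded-⇝ g       (⇝-μ {X} {X′} a) = Guarded-substAt-≤ (μ X) X′ z≤n (Guarded-⇝ g a) g

WF-⇝ : ∀ {X Y} → WF X → X ⇝ Y → WF Y
WF-⇝ wf         ⇝-refl    = wf
WF-⇝ wf         (⇝-σ a)   = WF-⇝ wf a
WF-⇝ (wf , wf′) (⇝-⊕ a b) = WF-⇝ wf a , WF-⇝ wf′ b
WF-⇝ (wf , wf′) (⇝-∥ a b) = WF-⇝ wf a , WF-⇝ wf′ b
WF-⇝ wf         (⇝-∖ a)   = WF-⇝ wf a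
WF-⇝ wf         (⇝-⟦⟧ a)  = WF-⇝ wf a
WF-⇝ (g , wf)   (⇝-μ {X} {X′} a) = WF-substAt (μ X) X′ (WF-⇝ wf a) (g , wf)

ClosedUnder-⇝ : ∀ {n X Y} → ClosedUnder n X → X ⇝ Y → ClosedUnder n Y
ClosedUnder-⇝ cl         ⇝-refl    = cl
ClosedUnder-⇝ cl         (⇝-σ a)   = ClosedUnder-⇝ cl a
ClosedUnder-⇝ (cl , cl′) (⇝-⊕ a b) = ClosedUnder-⇝ cl a , ClosedUnder-⇝ cl′ b
ClosedUnder-⇝ (cl , cl′) (⇝-∥ a b) = ClosedUnder-⇝ cl a , ClosedUnder-⇝ cl′ b
ClosedUnder-⇝ cl         (⇝-∖ a)   = ClosedUnder-⇝ cl a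
ClosedUnder-⇝ cl         (⇝-⟦⟧ a)  = ClosedUnder-⇝ cl a
ClosedUnder-⇝ cl         (⇝-μ {X} {X′} a) = ClosedUnder-substAt (μ X) X′ z≤n (ClosedUnder-⇝ cl a) cl

WF-act : ∀ {α X Y} → WF X → X —[ α ]→ Y → WF Y
WF-act wf         act       = wf
WF-act wf         (sig d)   = WF-act wf d
WF-act (wf , _)   (sumˡ d)  = WF-act wf d
WF-act (_ , wf)   (sumʳ d)  = WF-act wf d
WF-act (wf , wf′) (parˡ d)  = WF-act wf d , wf′
WF-act (wf , wf′) (parʳ d)  = wf , WF-act wf′ d
WF-act (wf , wf′) (com d e) = WF-act wf d , WF-act wf′ e
WF-act wf         (rel d)   = WF-act wf d
WF-act wf         (res d _) = WF-act wf d
WF-act (g , wf)   (rec {P = X} {X′} d) = WF-substAt (μ X) X′ (WF-act wf d) (g , wf)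

ClosedUnder-act : ∀ {n α X Y} → ClosedUnder n X → X —[ α ]→ Y → ClosedUnder n Y
ClosedUnder-act cl         act       = cl
ClosedUnder-act cl         (sig d)   = ClosedUnder-act cl d
ClosedUnder-act (cl , _)   (sumˡ d)  = ClosedUnder-act cl d
ClosedUnder-act (_ , cl)   (sumʳ d)  = ClosedUnder-act cl d
ClosedUnder-act (cl , cl′) (parˡ d)  = ClosedUnder-act cl d , cl′
ClosedUnder-act (cl , cl′) (parʳ d)  = cl , ClosedUnder-act cl′ d
ClosedUnder-act (cl , cl′) (com d e) = ClosedUnder-act cl d , ClosedUnder-act cl′ e
ClosedUnder-act cl         (rel d)   = ClosedUnder-act cl d
ClosedUnder-act cl         (res d _) = ClosedUnder-act cl d
ClosedUnder-act cl         (rec {P = X} {X′} d) = ClosedUnder-substAt (μ X) X′ z≤n (ClosedUnder-act cl d) cl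

⇝-reflect-act : ∀ {α X Y Y′} → WF X → X ⇝ Y → Y —[ α ]→ Y′ → ∃ λ X′ → X —[ α ]→ X′ × X′ ⇝ Y′
⇝-reflect-act wf ⇝-refl d = _ , d , ⇝-refl
⇝-reflect-act wf (⇝-σ a) d with ⇝-reflect-act wf a d
... | _ , d′ , a′ = _ , sig d′ , a′
⇝-reflect-act (wf , _) (⇝-⊕ a _) (sumˡ d) with ⇝-reflect-act wf a d
... | _ , d′ , a′ = _ , sumˡ d′ , a′
⇝-reflect-act (_ , wf) (⇝-⊕ _ b) (sumʳ d) with ⇝-reflect-act wf b d
... | _ , d′ , b′ = _ , sumʳ d′ , b′
⇝-reflect-act (wf , _) (⇝-∥ a b) (parˡ d) with ⇝-reflect-act wf a d
... | _ , d′ , a′ = _ , parˡ d′ , ⇝-∥ a′ b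
⇝-reflect-act (_ , wf) (⇝-∥ a b) (parʳ d) with ⇝-reflect-act wf b d
... | _ , d′ , b′ = _ , parʳ d′ , ⇝-∥ a b′
⇝-reflect-act (wf , wf′) (⇝-∥ a b) (com d e) with ⇝-reflect-act wf a d | ⇝-reflect-act wf′ b e
... | _ , d′ , a′ | _ , e′ , b′ = _ , com d′ e′ , ⇝-∥ a′ b′
⇝-reflect-act wf (⇝-∖ a) (res d l) with ⇝-reflect-act wf a d
... | _ , d′ , a′ = _ , res d′ l , ⇝-∖ a′
⇝-reflect-act wf (⇝-⟦⟧ a) (rel d) with ⇝-reflect-act wf a d
... | _ , d′ , a′ = _ , rel d′ , ⇝-⟦⟧ a′
⇝-reflect-act (g , wf) (⇝-μ {X} {X′} a) d with substAt-act⁻¹ X′ (Guarded-⇝ g a) d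
... | _ , d₀ , refl with ⇝-reflect-act wf a d₀
... | X″ , d′ , a′ = X″ [ μ X /0] , rec d′ , substAt-⇝ a′

⇝-preserve-act : ∀ {α X Y X′} → X ⇝ Y → X —[ α ]→ X′ → ∃ λ Y′ → Y —[ α ]→ Y′ × X′ ⇝ Y′
⇝-preserve-act ⇝-refl d = _ , d , ⇝-refl
⇝-preserve-act (⇝-σ a) (sig d) = ⇝-preserve-act a d
⇝-preserve-act (⇝-⊕ a _) (sumˡ d) with ⇝-preserve-act a d
... | _ , d′ , a′ = _ , sumˡ d′ , a′
⇝-preserve-act (⇝-⊕ _ b) (sumʳ d) with ⇝-preserve-act b d
... | _ , d′ , b′ = _ , sumʳ d′ , b′
⇝-preserve-act (⇝-∥ a b) (parˡ d) with ⇝-preserve-act a d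
... | _ , d′ , a′ = _ , parˡ d′ , ⇝-∥ a′ b
⇝-preserve-act (⇝-∥ a b) (parʳ d) with ⇝-preserve-act b d
... | _ , d′ , b′ = _ , parʳ d′ , ⇝-∥ a b′
⇝-preserve-act (⇝-∥ a b) (com d e) with ⇝-preserve-act a d | ⇝-preserve-act b e
... | _ , d′ , a′ | _ , e′ , b′ = _ , com d′ e′ , ⇝-∥ a′ b′
⇝-preserve-act (⇝-∖ a) (res d l) with ⇝-preserve-act a d
... | _ , d′ , a′ = _ , res d′ l , ⇝-∖ a′
⇝-preserve-act (⇝-⟦⟧ a) (rel d) with ⇝-preserve-act a d
... | _ , d′ , a′ = _ , rel d′ , ⇝-⟦⟧ a′
⇝-preserve-act (⇝-μ a) (rec d) with ⇝-preserve-act a d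
... | _ , d′ , a′ = _ , act-substAt d′ , substAt-⇝ a′

⇝*-⊕ : ∀ {X X′ Y Y′} → X ⇝* X′ → Y ⇝* Y′ → X ⊕ Y ⇝* X′ ⊕ Y′
⇝*-⊕ {X′ = X′} {Y} as bs = Star.gmap (_⊕ Y) (λ a → ⇝-⊕ a ⇝-refl) as ◅◅ Star.gmap (X′ ⊕_) (⇝-⊕ ⇝-refl) bs

⇝*-∥ : ∀ {X X′ Y Y′} → X ⇝* X′ → Y ⇝* Y′ → X ∥ Y ⇝* X′ ∥ Y′
⇝*-∥ {X′ = X′} {Y} as bs = Star.gmap (_∥ Y) (λ a → ⇝-∥ a ⇝-refl) as ◅◅ Star.gmap (X′ ∥_) (⇝-∥ ⇝-refl) bs

⇝-reflect-clk : ∀ {i X Y Y′} → WF X → X ⇝ Y → Y —σ[ i ]→ Y′ → ∃ λ X′ → X —σ[ c1 ]→ X′ × X′ ⇝* Y′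
⇝-reflect-clk wf ⇝-refl d with clk⇒clk₁⇝ d
... | _ , d′ , a = _ , d′ , a ◅ ε
⇝-reflect-clk wf (⇝-σ a) d = _ , t-sig , a ◅ clk⇒⇝ d ◅ ε
⇝-reflect-clk (wf , wf′) (⇝-⊕ a b) (t-sum d e) with ⇝-reflect-clk wf a d | ⇝-reflect-clk wf′ b e
... | _ , d′ , as | _ , e′ , bs = _ , t-sum d′ e′ , ⇝*-⊕ as bs
⇝-reflect-clk (wf , wf′) (⇝-∥ a b) (t-par d e τ∉) with ⇝-reflect-clk wf a d | ⇝-reflect-clk wf′ b e
... | _ , d′ , as | _ , e′ , bs = _ , t-par d′ e′ (λ u → τ∉ (∈U-⇝ u (⇝-∥ a b))) , ⇝*-∥ as bs
⇝-reflect-clk wf (⇝-∖ a) (t-res d) with ⇝-reflect-clk wf a d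
... | _ , d′ , as = _ , t-res d′ , Star.gmap (_∖ _) ⇝-∖ as
⇝-reflect-clk wf (⇝-⟦⟧ a) (t-rel d) with ⇝-reflect-clk wf a d
... | _ , d′ , as = _ , t-rel d′ , Star.gmap (_⟦ _ ⟧) ⇝-⟦⟧ as
⇝-reflect-clk (g , wf) (⇝-μ {X} {X′} a) d with substAt-clk⁻¹ X′ (Guarded-⇝ g a) d
... | _ , d₀ , refl with ⇝-reflect-clk wf a d₀
... | X″ , d′ , as = X″ [ μ X /0] , t-rec d′ , Star.gmap (_[ μ X /0]) substAt-⇝ as

⇝*-reflect-act : ∀ {α X Y Y′} → WF X → X ⇝* Y → Y —[ α ]→ Y′ → ∃ λ X′ → X —[ α ]→ X′ × X′ ⇝* Y′
⇝*-reflect-act wf ε d = _ , d , ε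
⇝*-reflect-act wf (a ◅ as) d with ⇝*-reflect-act (WF-⇝ wf a) as d
... | _ , d₁ , bs with ⇝-reflect-act wf a d₁
... | _ , d′ , b = _ , d′ , b ◅ bs

⇝*-preserve-act : ∀ {α X Y X′} → X ⇝* Y → X —[ α ]→ X′ → ∃ λ Y′ → Y —[ α ]→ Y′ × X′ ⇝* Y′
⇝*-preserve-act ε d = _ , d , ε
⇝*-preserve-act (a ◅ as) d with ⇝-preserve-act a d
... | _ , d₁ , b with ⇝*-preserve-act as d₁
... | _ , d′ , bs = _ , d′ , b ◅ bs

⇝*-reflect-clk : ∀ {i X Y Y′} → WF X → X ⇝* Y → Y —σ[ i ]→ Y′ → ∃ λ X′ → X —σ[ c1 ]→ X′ × X′ ⇝* Y′
⇝*-reflect-clk wf ε d with clk⇒clk₁⇝ d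
... | _ , d′ , a = _ , d′ , a ◅ ε
⇝*-reflect-clk wf (a ◅ as) d with ⇝*-reflect-clk (WF-⇝ wf a) as d
... | _ , d₁ , bs with ⇝-reflect-clk wf a d₁
... | _ , d′ , cs = _ , d′ , cs ◅◅ bs

wf : (P : Process) → WF (term P)
wf (_ , _ , w) = w

act-target : ∀ {α X} (P : Process) → term P —[ α ]→ X → Process
act-target {X = X} (_ , cl , w) d = X , ClosedUnder-act cl d , WF-act w d

clk-target : ∀ {i X} (P : Process) → term P —σ[ i ]→ X → Process
clk-target {X = X} (_ , cl , w) d = X , ClosedUnder-⇝ cl (clk⇒⇝ d) , WF-⇝ w (clk⇒⇝ d)

clk⁺-uncons : ∀ {i X Y} → X —σ[ i ]→⁺ Y → ∃ λ Z → X —σ[ i ]→ Z × Z ⇝* Y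
clk⁺-uncons [ d ] = _ , d , ε
clk⁺-uncons (d ∷ ds) with clk⁺-uncons ds
... | _ , d′ , as = _ , d , clk⇒⇝ d′ ◅ as

ActMatchedˡ : PRel → Process → Process → Set
ActMatchedˡ R P Q = ∀ α (P′ : Process) → term P —[ α ]→ term P′ →
                    ∃ λ (Q′ : Process) → term Q —[ α ]→ term Q′ × R P′ Q′

ActMatchedʳ : PRel → Process → Process → Set
ActMatchedʳ R P Q = ∀ α (Q′ : Process) → term Q —[ α ]→ term Q′ →
                    ∃ λ (P′ : Process) → term P —[ α ]→ term P′ × R P′ Q′

ClkMatched : Clk → PRel → Process → Process → Set
ClkMatched i R P Q = ∀ (P′ : Process) → term P —σ[ i ]→ term P′ →
                     ∃ λ (Q′ : Process) → term Q —σ[ i ]→ term Q′ × R P′ Q′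

delayedʳ : PRel → PRel
delayedʳ R P Q = ∃ λ (Q₀ : Process) → R P Q₀ × term Q ⇝* term Q₀

advancedˡ : PRel → PRel
advancedˡ R P Q = ∃ λ (P₀ : Process) → term P₀ ⇝* term P × R P₀ Q

naive⇒delayed : ∀ {i R} → IsNaive i R → IsDelayed i R
naive⇒delayed nv P Q PRQ with nv P Q PRQ
... | matchˡ , matchʳ , matchσ =
  (λ α P′ d → let Q′ , d′ , r = matchˡ α P′ d in Q′ , (_ , _ , ε , d′ , ε) , r) ,
  matchʳ ,
  (λ P′ d → let Q′ , d′ , r = matchσ P′ d in Q′ , [ d′ ] , r)

delayed⇒naive₁ : ∀ {i R} → IsDelayed i R → IsNaive c1 (delayedʳ R)
delayed⇒naive₁ {R = R} dly P Q (Q₀ , PRQ₀ , Q⇝*Q₀) with dly P Q₀ PRQ₀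
... | matchˡ , matchʳ , matchσ = matchˡ′ , matchʳ′ , matchσ′
  where
  matchˡ′ : ActMatchedˡ (delayedʳ R) P Q
  matchˡ′ α P′ d with matchˡ α P′ d
  ... | Q₀′ , (_ , _ , Q₀→*Q₁ , d₁ , Q₂→*Q₀′) , r
      with ⇝*-reflect-act (wf Q) (Q⇝*Q₀ ◅◅ clk*⇒⇝* Q₀→*Q₁) d₁
  ... | _ , d′ , as = act-target Q d′ , d′ , (Q₀′ , r , as ◅◅ clk*⇒⇝* Q₂→*Q₀′)

  matchʳ′ : ActMatchedʳ (delayedʳ R) P Q
  matchʳ′ α Q′ d with ⇝*-preserve-act Q⇝*Q₀ d
  ... | _ , d₀ , as with matchʳ α (act-target Q₀ d₀) d₀
  ... | P′ , d′ , r = P′ , d′ , (act-target Q₀ d₀ , r , as)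

  matchσ′ : ClkMatched c1 (delayedʳ R) P Q
  matchσ′ P′ d with matchσ P′ (clk₁⇒clk d)
  ... | Q₀′ , Q₀→⁺Q₀′ , r with clk⁺-uncons Q₀→⁺Q₀′
  ... | _ , d₀ , bs with ⇝*-reflect-clk (wf Q) Q⇝*Q₀ d₀
  ... | _ , d′ , as = clk-target Q d′ , d′ , (Q₀′ , r , as ◅◅ bs)

naive₁⇒naive₂ : ∀ {R} → IsNaive c1 R → IsNaive c2 (advancedˡ R)
naive₁⇒naive₂ {R} nv P Q (P₀ , P₀⇝*P , P₀RQ) with nv P₀ Q P₀RQ
... | matchˡ , matchʳ , matchσ = matchˡ′ , matchʳ′ , matchσ′
  where
  matchˡ′ : ActMatchedˡ (advancedˡ R) P Q
  matchˡ′ α P′ d with ⇝*-reflect-act (wf P₀) P₀⇝*P d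
  ... | _ , d₀ , as with matchˡ α (act-target P₀ d₀) d₀
  ... | Q′ , d′ , r = Q′ , d′ , (act-target P₀ d₀ , as , r)

  matchʳ′ : ActMatchedʳ (advancedˡ R) P Q
  matchʳ′ α Q′ d with matchʳ α Q′ d
  ... | P₀′ , d₀ , r with ⇝*-preserve-act P₀⇝*P d₀
  ... | _ , d′ , as = act-target P d′ , d′ , (P₀′ , as , r)

  matchσ′ : ClkMatched c2 (advancedˡ R) P Q
  matchσ′ P′ d with ⇝*-reflect-clk (wf P₀) P₀⇝*P d
  ... | _ , d₀ , as with matchσ (clk-target P₀ d₀) d₀
  ... | Q′ , d′ , r = Q′ , clk₁⇒clk d′ , (clk-target P₀ d₀ , as , r)

⊒nv⇒⊒dly : ∀ {i P Q} → P ⊒nv[ i ] Q → P ⊒dly[ i ] Q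
⊒nv⇒⊒dly (R , nv , PRQ) = R , naive⇒delayed nv , PRQ

⊒dly⇒⊒nv₁ : ∀ {i P Q} → P ⊒dly[ i ] Q → P ⊒nv[ c1 ] Q
⊒dly⇒⊒nv₁ {Q = Q} (R , dly , PRQ) = delayedʳ R , delayed⇒naive₁ dly , (Q , PRQ , ε)

⊒nv₁⇒⊒nv₂ : ∀ {P Q} → P ⊒nv[ c1 ] Q → P ⊒nv[ c2 ] Q
⊒nv₁⇒⊒nv₂ {P} (R , nv , PRQ) = advancedˡ R , naive₁⇒naive₂ nv , (P , ε , PRQ)

theorem13 : ∀ (P Q : Process) →
    ((P ⊒nv[ c1 ] Q) ⇔ (P ⊒nv[ c2 ] Q))
    × ((P ⊒nv[ c1 ] Q) ⇔ (P ⊒dly[ c1 ] Q))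
    × ((P ⊒nv[ c1 ] Q) ⇔ (P ⊒dly[ c2 ] Q))
theorem13 P Q =
  mk⇔ ⊒nv₁⇒⊒nv₂ (⊒dly⇒⊒nv₁ ∘ ⊒nv⇒⊒dly) ,
  mk⇔ ⊒nv⇒⊒dly ⊒dly⇒⊒nv₁ ,
  mk⇔ (⊒nv⇒⊒dly ∘ ⊒nv₁⇒⊒nv₂) ⊒dly⇒⊒nv₁
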